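{- Let $G=(V\cup\{m\},E)$ and $G'=(V'\cup\{m'\},E')$ be comparability graphs with disjoint vertex sets such that $m$ is adjacent to all vertices of $V$ in $G$ or $m'$ is adjacent to all vertices of $V'$ in $G'$ (or both). Then $G\ast G'$ is a comparability graph. Moreover, if $\mathcal{R}^p(G)=k$ and $\mathcal{R}^p(G')=k'$, then $\mathcal{R}^p(G\ast G')=\max\{k,k'\}$.
   Context: All graphs are finite, simple and connected. A comparability graph is a graph admitting a transitive orientation ($\overrightarrow{ab},\overrightarrow{bc}$ imply $\overrightarrow{ac}$). A word over the vertex set represents a graph if distinct vertices are adjacent iff they alternate in the word (the subword formed by their occurrences is $abab\cdots$ or $baba\cdots$). Comparability graphs are exactly the graphs represented by a concatenation of permutations of their vertex set; $\mathcal{R}^p(G)$ is the least number of permutations whose concatenation represents $G$. Split recomposition: $G\ast G'$ has vertex set $V\cup V'$ and edges: those of $G[V]$, those of $G'[V']$, and all $\overline{ab}$ with $a\in N_G(m)$, $b\in N_{G'}(m')$. -}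

module Defs where

open import Data.Nat using (ℕ; zero; suc; _+_; _≤_; _⊔_)
open import Data.Fin using (Fin; splitAt; _≟_) renaming (zero to fzero; suc to fsuc)
open import Data.List using (List; []; _∷_; filter; concat; allFin)
open import Data.List.Membership.Propositional using (_∈_)
open import Data.List.Relation.Binary.Permutation.Propositional using (_↭_)
open import Data.Vec using (Vec; lookup; toList)
open import Data.Sum using (_⊎_; inj₁; inj₂)
open import Data.Product using (_×_; Σ; _,_; proj₁; proj₂)
open import Data.Unit using (⊤)
open import Data.Empty using (⊥)
open import Relation.Nullary using (¬_)
open import Relation.Nullary.Decidable using (_⊎-dec_)
open import Relation.Binary.PropositionalEquality using (_≡_; _≢_)
open import Relation.Binary.Construct.Closure.ReflexiveTransitive using (Star)
open import Function.Bundles using (_⇔_)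

record Graph (N : ℕ) : Set₁ where
  field
    Adj    : Fin N → Fin N → Set
    sym    : ∀ {x y} → Adj x y → Adj y x
    irrefl : ∀ {x} → ¬ Adj x x
open Graph public

Connected : ∀ {N} → Graph N → Set
Connected G = ∀ x y → Star (Adj G) x y

record TransitiveOrientation {N} (G : Graph N) : Set₁ where
  field
    Arc       : Fin N → Fin N → Set
    arc⇒adj   : ∀ {x y} → Arc x y → Adj G x y
    adj⇒arc   : ∀ {x y} → Adj G x y → Arc x y ⊎ Arc y x
    antisym   : ∀ {x y} → Arc x y → ¬ Arc y x
    trans     : ∀ {x y z} → Arc x y → Arc y z → Arc x z

Comparability : ∀ {N} → Graph N → Set₁
Comparability G = TransitiveOrientation G

NoConsecRepeat : ∀ {A : Set} → List A → Set
NoConsecRepeat []           = ⊤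
NoConsecRepeat (x ∷ [])     = ⊤
NoConsecRepeat (x ∷ y ∷ r)  = x ≢ y × NoConsecRepeat (y ∷ r)

subword : ∀ {N} → List (Fin N) → Fin N → Fin N → List (Fin N)
subword w x y = filter (λ z → (z ≟ x) ⊎-dec (z ≟ y)) w

Alternate : ∀ {N} → List (Fin N) → Fin N → Fin N → Set
Alternate w x y = NoConsecRepeat (subword w x y)

Represents : ∀ {N} → List (Fin N) → Graph N → Set
Represents w G =
  (∀ v → v ∈ w) × (∀ x y → x ≢ y → (Adj G x y ⇔ Alternate w x y))

PermRepresentable : ∀ {N} → Graph N → ℕ → Set
PermRepresentable {N} G k =
  Σ (Vec (List (Fin N)) k) λ ps →
    (∀ i → lookup ps i ↭ allFin N) × Represents (concat (toList ps)) G

Rp≡ : ∀ {N} → Graph N → ℕ → Set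
Rp≡ G k = PermRepresentable G k × (∀ j → PermRepresentable G j → k ≤ j)

-- Split recomposition. G has vertex set V ∪ {m} = Fin (suc n) with m = zero
-- and V = {suc v}; G' likewise with m' = zero. G ∗ G' has vertex set
-- Fin (n + n') ≅ V ⊎ V' via splitAt.
module _ {n n' : ℕ} (G : Graph (suc n)) (G' : Graph (suc n')) where
  SAdj : Fin n ⊎ Fin n' → Fin n ⊎ Fin n' → Set
  SAdj (inj₁ a) (inj₁ b) = Adj G (fsuc a) (fsuc b)
  SAdj (inj₂ a) (inj₂ b) = Adj G' (fsuc a) (fsuc b)
  SAdj (inj₁ a) (inj₂ b) = Adj G fzero (fsuc a) × Adj G' fzero (fsuc b)
  SAdj (inj₂ b) (inj₁ a) = Adj G fzero (fsuc a) × Adj G' fzero (fsuc b)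

  SAdj-sym : ∀ s t → SAdj s t → SAdj t s
  SAdj-sym (inj₁ a) (inj₁ b) p = sym G p
  SAdj-sym (inj₂ a) (inj₂ b) p = sym G' p
  SAdj-sym (inj₁ a) (inj₂ b) p = p
  SAdj-sym (inj₂ b) (inj₁ a) p = p

  SAdj-irrefl : ∀ s → ¬ SAdj s s
  SAdj-irrefl (inj₁ a) = irrefl G
  SAdj-irrefl (inj₂ a) = irrefl G'

  _∗_ : Graph (n + n')
  _∗_ = record
    { Adj    = λ x y → SAdj (splitAt n x) (splitAt n y)
    ; sym    = λ {x} {y} → SAdj-sym (splitAt n x) (splitAt n y)
    ; irrefl = λ {x} → SAdj-irrefl (splitAt n x)
    }

-- A concatenation of permutations represents a graph exactly when two distinct vertices are
-- adjacent iff they occur in the same order in every permutation. A representation by k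
-- permutations is thus a family of k orders with this property, and repeating one of the orders
-- pads it to any larger number of permutations.
--
-- If m is adjacent to all of V, then G ∗ G' is G' with the vertex m' replaced by G[V]. Orienting
-- G[V] as in G and every other edge as in G', each vertex of V standing in for m', is then
-- transitive; and replacing m' in the i-th permutation of G' by the i-th permutation of G
-- restricted to V represents G ∗ G'. The case where m' is adjacent to all of V' follows from G ∗ G' ≅ G' ∗ G.
--
-- Conversely, if a is a neighbour of m (one exists as G is connected), then sending m' to a and
-- fixing V' makes G' an induced subgraph of G ∗ G'. Restricting the permutations of a
-- representation to an induced subgraph represents the subgraph, so R^p(G') ≤ R^p(G ∗ G');
-- symmetrically R^p(G) ≤ R^p(G ∗ G').

module Submission where

open import Defs
open import Data.Nat using (ℕ; suc; _≤_; _⊔_)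
open import Data.Fin using (Fin) renaming (zero to fzero; suc to fsuc)
open import Data.Sum using (_⊎_)
open import Data.Product using (_×_)

open import Data.Nat.Base using (zero; _+_; s≤s; _⊓_)
open import Data.Nat.Properties using (m≤m⊔n; m≤n⊔m; ⊔-lub; m⊓n≤n; m≤n⇒m⊓n≡m)
open import Data.Fin.Base using (join; splitAt; toℕ; fromℕ<; inject≤)
open import Data.Fin.Properties
  using (_≟_; any?; suc-injective; splitAt-join; join-splitAt
        ; toℕ-injective; toℕ-fromℕ<; toℕ-inject≤; toℕ≤pred[n])
open import Data.List.Base as List using (List; []; _∷_; _++_; [_]; map; mapMaybe; concat; concatMap; allFin)
open import Data.List.Properties
  using (∷-injectiveˡ; filter-accept; filter-reject; filter-none; filter-++; filter-≐)
open import Data.List.Membership.Propositional using (_∈_; lose)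
open import Data.List.Membership.Propositional.Properties
  using (∈-++⁺ˡ; ∈-++⁺ʳ; ∈-map⁺; ∈-map⁻; ∈-concatMap⁺; ∈-allFin)
open import Data.List.Membership.Propositional.Properties.WithK using (unique∧set⇒bag)
open import Data.List.Relation.Unary.Any using (here; there)
open import Data.List.Relation.Unary.All as All using (All; []; _∷_)
import Data.List.Relation.Unary.All.Properties as All
open import Data.List.Relation.Unary.AllPairs as AllPairs using ([]; _∷_)
import Data.List.Relation.Unary.AllPairs.Properties as AllPairs
open import Data.List.Relation.Unary.Unique.Propositional using (Unique)
import Data.List.Relation.Unary.Unique.Propositional.Properties as Unique
open import Data.List.Relation.Binary.Disjoint.Propositional using (Disjoint)
open import Data.List.Relation.Binary.Permutation.Propositional using (_↭_; ↭-sym; ↭⇒↭ₛ)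
open import Data.List.Relation.Binary.Permutation.Propositional.Properties using (∈-resp-↭)
open import Data.List.Relation.Binary.Permutation.Setoid.Properties using (Unique-resp-↭)
open import Data.List.Relation.Binary.BagAndSetEquality using (∼bag⇒↭)
open import Data.Maybe.Base using (Maybe; just; nothing)
import Data.Maybe.Relation.Unary.All as Maybe
open import Data.Vec.Base as Vec using (Vec; lookup; toList)
open import Data.Vec.Properties using (lookup∘tabulate)
open import Data.Sum.Base as Sum using (inj₁; inj₂)
open import Data.Sum.Properties using (inj₁-injective; swap-involutive)
open import Data.Sum.Function.Propositional using (_⊎-⇔_)
open import Data.Product.Base using (∃; _,_; proj₁; proj₂) renaming (swap to ×-swap)
open import Data.Unit.Base using (tt)
open import Data.Empty using (⊥; ⊥-elim)
open import Function.Base using (_∘_; id)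
open import Function.Bundles using (_⇔_; mk⇔; Equivalence)
open import Function.Definitions using (Injective)
open import Function.Construct.Composition using (_⇔-∘_)
open import Function.Construct.Symmetry using (⇔-sym)
open import Function.Related.Propositional using (module EquationalReasoning)
open import Relation.Nullary using (¬_; yes; no)
open import Relation.Nullary.Decidable using (_⊎-dec_)
open import Relation.Binary.Construct.Closure.ReflexiveTransitive using (_◅_)
open import Relation.Binary.PropositionalEquality
  using (setoid; _≡_; _≢_; refl; cong; cong₂; subst; subst₂; ≢-sym; module ≡-Reasoning)
  renaming (sym to ≡-sym; trans to ≡-trans)

open Equivalence using (to; from)

private
  variable
    A B : Set
    M N k : ℕ

-- Order of letters in a word

data Precedes {A : Set} : List A → A → A → Set where
  here  : ∀ {x y l} → y ∈ l → Precedes (x ∷ l) x y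
  there : ∀ {x y z l} → Precedes l x y → Precedes (z ∷ l) x y

Precedes-∈ˡ : ∀ {l} {x y : A} → Precedes l x y → x ∈ l
Precedes-∈ˡ (here _)  = here refl
Precedes-∈ˡ (there p) = there (Precedes-∈ˡ p)

Precedes-∈ʳ : ∀ {l} {x y : A} → Precedes l x y → y ∈ l
Precedes-∈ʳ (here y∈l) = there y∈l
Precedes-∈ʳ (there p)  = there (Precedes-∈ʳ p)

Precedes-asym : ∀ {l} {x y : A} → Unique l → Precedes l x y → ¬ Precedes l y x
Precedes-asym (x∉l ∷ _) (here _)  (here x∈l) = All.lookup x∉l x∈l refl
Precedes-asym (x∉l ∷ _) (here _)  (there q)  = All.lookup x∉l (Precedes-∈ʳ q) refl
Precedes-asym (y∉l ∷ _) (there p) (here _)   = All.lookup y∉l (Precedes-∈ʳ p) refl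
Precedes-asym (_ ∷ u)   (there p) (there q)  = Precedes-asym u p q

module _ {x y : A} where

  Precedes-++⁺ˡ : ∀ {l} r → Precedes l x y → Precedes (l ++ r) x y
  Precedes-++⁺ˡ r (here y∈l) = here (∈-++⁺ˡ y∈l)
  Precedes-++⁺ˡ r (there p)  = there (Precedes-++⁺ˡ r p)

  Precedes-++⁺ʳ : ∀ l {r} → Precedes r x y → Precedes (l ++ r) x y
  Precedes-++⁺ʳ []      p = p
  Precedes-++⁺ʳ (_ ∷ l) p = there (Precedes-++⁺ʳ l p)

  Precedes-++⁺ : ∀ {l r} → x ∈ l → y ∈ r → Precedes (l ++ r) x y
  Precedes-++⁺ {_ ∷ l} (here refl) y∈r = here (∈-++⁺ʳ l y∈r)
  Precedes-++⁺         (there x∈l) y∈r = there (Precedes-++⁺ x∈l y∈r)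

  Precedes-total : ∀ {l} → x ∈ l → y ∈ l → x ≢ y → Precedes l x y ⊎ Precedes l y x
  Precedes-total (here refl) (here refl) x≢y = ⊥-elim (x≢y refl)
  Precedes-total (here refl) (there y∈l) _   = inj₁ (here y∈l)
  Precedes-total (there x∈l) (here refl) _   = inj₂ (here x∈l)
  Precedes-total (there x∈l) (there y∈l) x≢y =
    Sum.map there there (Precedes-total x∈l y∈l x≢y)

Precedes-map⁺ : ∀ (f : A → B) {l x y} → Precedes l x y → Precedes (map f l) (f x) (f y)
Precedes-map⁺ f (here y∈l) = here (∈-map⁺ f y∈l)
Precedes-map⁺ f (there p)  = there (Precedes-map⁺ f p)

module _ (f : A → Maybe B) where

  ∈-mapMaybe⁺ : ∀ {l y x} → y ∈ l → f y ≡ just x → x ∈ mapMaybe f l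
  ∈-mapMaybe⁺ {z ∷ _} (here refl) fy≡x with f z
  ... | just _ with refl ← fy≡x = here refl
  ∈-mapMaybe⁺ {z ∷ _} (there y∈l) fy≡x with f z
  ... | just _  = there (∈-mapMaybe⁺ y∈l fy≡x)
  ... | nothing = ∈-mapMaybe⁺ y∈l fy≡x

  Precedes-mapMaybe⁺ : ∀ {l y y' x x'} → Precedes l y y' → f y ≡ just x → f y' ≡ just x' →
                       Precedes (mapMaybe f l) x x'
  Precedes-mapMaybe⁺ {z ∷ _} (here y'∈l) fy≡x fy'≡x' with f z
  ... | just _ with refl ← fy≡x = here (∈-mapMaybe⁺ y'∈l fy'≡x')
  Precedes-mapMaybe⁺ {z ∷ _} (there p) fy≡x fy'≡x' with f z
  ... | just _  = there (Precedes-mapMaybe⁺ p fy≡x fy'≡x')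
  ... | nothing = Precedes-mapMaybe⁺ p fy≡x fy'≡x'

  Unique-mapMaybe⁺ : (∀ {y y' x} → f y ≡ just x → f y' ≡ just x → y ≡ y') →
                     ∀ {l} → Unique l → Unique (mapMaybe f l)
  Unique-mapMaybe⁺ f-inj {[]}    []         = []
  Unique-mapMaybe⁺ f-inj {z ∷ l} (z∉l ∷ u) with f z in fz
  ... | nothing = Unique-mapMaybe⁺ f-inj u
  ... | just x  = x∉ ∷ Unique-mapMaybe⁺ f-inj u
    where
    avoid : ∀ {y} → z ≢ y → Maybe.All (x ≢_) (f y)
    avoid {y} z≢y with f y in fy
    ... | nothing = Maybe.nothing
    ... | just _  = Maybe.just λ { refl → z≢y (f-inj fz fy) }
    x∉ : All (x ≢_) (mapMaybe f l)
    x∉ = All.mapMaybe⁺ (All.map⁺ (All.map avoid z∉l))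

module _ (h : A → List B) {u v : B} where

  Precedes-concatMap⁺-within : ∀ {l z} → z ∈ l → Precedes (h z) u v → Precedes (concatMap h l) u v
  Precedes-concatMap⁺-within {z ∷ l} (here refl) p = Precedes-++⁺ˡ (concatMap h l) p
  Precedes-concatMap⁺-within {w ∷ _} (there z∈l) p =
    Precedes-++⁺ʳ (h w) (Precedes-concatMap⁺-within z∈l p)

  Precedes-concatMap⁺-across : ∀ {l z z'} → Precedes l z z' → u ∈ h z → v ∈ h z' →
                         Precedes (concatMap h l) u v
  Precedes-concatMap⁺-across (here z'∈l) u∈ v∈ =
    Precedes-++⁺ u∈ (∈-concatMap⁺ h (lose z'∈l v∈))
  Precedes-concatMap⁺-across {w ∷ _} (there p) u∈ v∈ =
    Precedes-++⁺ʳ (h w) (Precedes-concatMap⁺-across p u∈ v∈)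

Enumerates : List A → Set
Enumerates l = Unique l × (∀ x → x ∈ l)

↭allFin⇔Enumerates : ∀ {p : List (Fin N)} → (p ↭ allFin N) ⇔ Enumerates p
↭allFin⇔Enumerates {N} = mk⇔
  (λ p↭ → Unique-resp-↭ (setoid _) (↭⇒↭ₛ (↭-sym p↭)) (Unique.allFin⁺ N) ,
          λ x → ∈-resp-↭ (↭-sym p↭) (∈-allFin x))
  (λ (u , complete) → ∼bag⇒↭ (unique∧set⇒bag u (Unique.allFin⁺ N)
                                 (mk⇔ (λ _ → ∈-allFin _) (λ _ → complete _))))

Enumerates-map⁺ : ∀ {f : A → B} → Injective _≡_ _≡_ f → (∀ y → ∃ λ x → f x ≡ y) →
                  ∀ {l} → Enumerates l → Enumerates (map f l)
Enumerates-map⁺ {f = f} f-inj f-surj (u , complete) =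
  Unique.map⁺ f-inj u , λ y → subst (_∈ _) (proj₂ (f-surj y)) (∈-map⁺ f (complete _))

-- Alternation in a concatenation of permutations

subword-comm : ∀ (p : List (Fin N)) x y → subword p x y ≡ subword p y x
subword-comm p x y = filter-≐ _ _ (Sum.swap , Sum.swap) p

module _ {x y : Fin N} where

  private
    xy? = λ z → (z ≟ x) ⊎-dec (z ≟ y)

  subword-single : ∀ {l} → All (x ≢_) l → Unique l → y ∈ l → subword l x y ≡ [ y ]
  subword-single (_ ∷ x∉l) (y∉l ∷ _) (here refl) =
    ≡-trans (filter-accept xy? (inj₂ refl))
            (cong (y ∷_) (filter-none xy? (All.zipWith (λ (x≢z , y≢z) → Sum.[ x≢z ∘ ≡-sym , y≢z ∘ ≡-sym ])
                                                      (x∉l , y∉l))))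
  subword-single (x≢z ∷ x∉l) (z∉l ∷ u) (there y∈l) =
    ≡-trans (filter-reject xy? Sum.[ x≢z ∘ ≡-sym , All.lookup z∉l y∈l ]) (subword-single x∉l u y∈l)

  subword-precedes : ∀ {l} → Unique l → Precedes l x y → subword l x y ≡ x ∷ y ∷ []
  subword-precedes (x∉l ∷ u) (here y∈l) =
    ≡-trans (filter-accept xy? (inj₁ refl)) (cong (x ∷_) (subword-single x∉l u y∈l))
  subword-precedes (z∉l ∷ u) (there p) =
    ≡-trans (filter-reject xy? Sum.[ All.lookup z∉l (Precedes-∈ˡ p) , All.lookup z∉l (Precedes-∈ʳ p) ])
            (subword-precedes u p)

Block : A → A → List A → Set
Block x y b = b ≡ x ∷ y ∷ [] ⊎ b ≡ y ∷ x ∷ []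

module _ {x y : A} (x≢y : x ≢ y) where

  NoConsecRepeat-after : ∀ {bs} → All (Block x y) bs →
                         NoConsecRepeat (x ∷ y ∷ concat bs) ⇔ All (_≡ x ∷ y ∷ []) bs
  NoConsecRepeat-after [] = mk⇔ (λ _ → []) (λ _ → x≢y , tt)
  NoConsecRepeat-after (inj₁ refl ∷ bs) = mk⇔
    (λ (_ , _ , ncr) → refl ∷ to (NoConsecRepeat-after bs) ncr)
    (λ { (_ ∷ all) → x≢y , ≢-sym x≢y , from (NoConsecRepeat-after bs) all })
  NoConsecRepeat-after (inj₂ refl ∷ bs) = mk⇔
    (λ (_ , y≢y , _) → ⊥-elim (y≢y refl))
    (λ { (yx≡xy ∷ _) → ⊥-elim (x≢y (≡-sym (∷-injectiveˡ yx≡xy))) })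

NoConsecRepeat-blocks : ∀ {x y : A} {bs} → x ≢ y → All (Block x y) bs →
                        NoConsecRepeat (concat bs) ⇔ (All (_≡ x ∷ y ∷ []) bs ⊎ All (_≡ y ∷ x ∷ []) bs)
NoConsecRepeat-blocks x≢y [] = mk⇔ (λ _ → inj₁ []) (λ _ → tt)
NoConsecRepeat-blocks x≢y (inj₁ refl ∷ bs) = mk⇔
  (λ ncr → inj₁ (refl ∷ to (NoConsecRepeat-after x≢y bs) ncr))
  (λ { (inj₁ (_ ∷ all))   → from (NoConsecRepeat-after x≢y bs) all
     ; (inj₂ (xy≡yx ∷ _)) → ⊥-elim (x≢y (∷-injectiveˡ xy≡yx)) })
NoConsecRepeat-blocks x≢y (inj₂ refl ∷ bs) = mk⇔
  (λ ncr → inj₂ (refl ∷ to (NoConsecRepeat-after y≢x (All.map Sum.swap bs)) ncr))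
  (λ { (inj₁ (yx≡xy ∷ _)) → ⊥-elim (y≢x (∷-injectiveˡ yx≡xy))
     ; (inj₂ (_ ∷ all))   → from (NoConsecRepeat-after y≢x (All.map Sum.swap bs)) all })
  where y≢x = ≢-sym x≢y

Uniform : (Fin k → List A) → A → A → Set
Uniform F x y = (∀ i → Precedes (F i) x y) ⊎ (∀ i → Precedes (F i) y x)

module _ {p : List (Fin N)} {x y : Fin N} (enum : Enumerates p) (x≢y : x ≢ y) where

  private
    total : Precedes p x y ⊎ Precedes p y x
    total = Precedes-total (proj₂ enum x) (proj₂ enum y) x≢y

    xy≢yx : x ∷ y ∷ [] ≢ y ∷ x ∷ []
    xy≢yx = x≢y ∘ ∷-injectiveˡ

    subword-xy : Precedes p x y → subword p x y ≡ x ∷ y ∷ []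
    subword-xy = subword-precedes (proj₁ enum)

    subword-yx : Precedes p y x → subword p x y ≡ y ∷ x ∷ []
    subword-yx = ≡-trans (subword-comm p x y) ∘ subword-precedes (proj₁ enum)

  subword-block : Block x y (subword p x y)
  subword-block = Sum.map subword-xy subword-yx total

  subword≡xy⇔Precedes : (subword p x y ≡ x ∷ y ∷ []) ⇔ Precedes p x y
  subword≡xy⇔Precedes = mk⇔
    (λ sub≡xy → Sum.[ id , (λ y<x → ⊥-elim (xy≢yx (≡-trans (≡-sym sub≡xy) (subword-yx y<x)))) ] total)
    subword-xy

  subword≡yx⇔Precedes : (subword p x y ≡ y ∷ x ∷ []) ⇔ Precedes p y x
  subword≡yx⇔Precedes = mk⇔
    (λ sub≡yx → Sum.[ (λ x<y → ⊥-elim (xy≢yx (≡-trans (≡-sym (subword-xy x<y)) sub≡yx))) , id ] total)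
    subword-yx

All-tabulate⇔ : ∀ {P : A → Set} {f : Fin k → A} → All P (List.tabulate f) ⇔ (∀ i → P (f i))
All-tabulate⇔ = mk⇔ All.tabulate⁻ All.tabulate⁺

∀-⇔ : ∀ {P Q : Fin k → Set} → (∀ i → P i ⇔ Q i) → (∀ i → P i) ⇔ (∀ i → Q i)
∀-⇔ P⇔Q = mk⇔ (λ h i → to (P⇔Q i) (h i)) (λ h i → from (P⇔Q i) (h i))

subword-concat : ∀ {k} (F : Fin k → List (Fin N)) x y →
                 subword (concat (List.tabulate F)) x y ≡ concat (List.tabulate λ i → subword (F i) x y)
subword-concat {k = zero}  F x y = refl
subword-concat {k = suc k} F x y =
  ≡-trans (filter-++ _ (F fzero) _) (cong (subword (F fzero) x y ++_) (subword-concat (F ∘ fsuc) x y))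

Alternate⇔Uniform : ∀ {F : Fin k → List (Fin N)} {x y} → (∀ i → Enumerates (F i)) → x ≢ y →
                    Alternate (concat (List.tabulate F)) x y ⇔ Uniform F x y
Alternate⇔Uniform {F = F} {x} {y} enum x≢y = begin
  Alternate (concat (List.tabulate F)) x y
    ≡⟨ cong NoConsecRepeat (subword-concat F x y) ⟩
  NoConsecRepeat (concat (List.tabulate S))
    ∼⟨ NoConsecRepeat-blocks x≢y (All.tabulate⁺ λ i → subword-block (enum i) x≢y) ⟩
  (All (_≡ x ∷ y ∷ []) (List.tabulate S) ⊎ All (_≡ y ∷ x ∷ []) (List.tabulate S))
    ∼⟨ All-tabulate⇔ ⊎-⇔ All-tabulate⇔ ⟩
  ((∀ i → S i ≡ x ∷ y ∷ []) ⊎ (∀ i → S i ≡ y ∷ x ∷ []))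
    ∼⟨ ∀-⇔ (λ i → subword≡xy⇔Precedes (enum i) x≢y) ⊎-⇔
       ∀-⇔ (λ i → subword≡yx⇔Precedes (enum i) x≢y) ⟩
  Uniform F x y ∎
  where
  open EquationalReasoning
  S = λ i → subword (F i) x y

-- Representations by families of orders

record Realizer (G : Graph N) (F : Fin k → List (Fin N)) : Set where
  constructor mkRealizer
  field
    enumerates : ∀ i → Enumerates (F i)
    realizes   : ∀ x y → x ≢ y → Adj G x y ⇔ Uniform F x y

toList-lookup : ∀ (ps : Vec A k) → toList ps ≡ List.tabulate (lookup ps)
toList-lookup Vec.[]       = refl
toList-lookup (p Vec.∷ ps) = cong (p ∷_) (toList-lookup ps)

toList-tabulate : ∀ (F : Fin k → A) → toList (Vec.tabulate F) ≡ List.tabulate F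
toList-tabulate {k = zero}  F = refl
toList-tabulate {k = suc k} F = cong (F fzero ∷_) (toList-tabulate (F ∘ fsuc))

PermRepresentable⇒Realizer : ∀ {G : Graph N} → PermRepresentable G k → ∃ (Realizer G)
PermRepresentable⇒Realizer {G = G} (ps , perm , _ , represents) =
  lookup ps , mkRealizer enum λ x y x≢y → begin
    Adj G x y                                          ∼⟨ represents x y x≢y ⟩
    Alternate (concat (toList ps)) x y                 ≡⟨ cong (λ w → Alternate (concat w) x y) (toList-lookup ps) ⟩
    Alternate (concat (List.tabulate (lookup ps))) x y ∼⟨ Alternate⇔Uniform enum x≢y ⟩
    Uniform (lookup ps) x y                            ∎
  where
  open EquationalReasoning
  enum = λ i → to ↭allFin⇔Enumerates (perm i)

Realizer⇒PermRepresentable : ∀ {G : Graph N} {F : Fin (suc k) → List (Fin N)} → Realizer G F →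
                             PermRepresentable G (suc k)
Realizer⇒PermRepresentable {G = G} {F = F} (mkRealizer enum realizes) =
  Vec.tabulate F , perm , covers , represents
  where
  open EquationalReasoning
  perm = λ i → from ↭allFin⇔Enumerates (subst Enumerates (≡-sym (lookup∘tabulate F i)) (enum i))
  covers = λ v → subst (λ w → v ∈ concat w) (≡-sym (toList-tabulate F)) (∈-++⁺ˡ (proj₂ (enum fzero) v))
  represents = λ x y x≢y → begin
    Adj G x y                                        ∼⟨ realizes x y x≢y ⟩
    Uniform F x y                                    ∼⟨ ⇔-sym (Alternate⇔Uniform enum x≢y) ⟩
    Alternate (concat (List.tabulate F)) x y
      ≡⟨ cong (λ w → Alternate (concat w) x y) (≡-sym (toList-tabulate F)) ⟩
    Alternate (concat (toList (Vec.tabulate F))) x y ∎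

PermRepresentable-zero : ∀ {G : Graph (suc N)} → ¬ PermRepresentable G 0
PermRepresentable-zero (Vec.[] , _ , covers , _) with () ← covers fzero

Uniform-reindex : ∀ {K} {F : Fin k → List A} {x y} (r : Fin K → Fin k) → (∀ j → ∃ λ i → r i ≡ j) →
                  Uniform (F ∘ r) x y ⇔ Uniform F x y
Uniform-reindex {F = F} {x} {y} r r-surjective =
  mk⇔ (Sum.map (pull λ j → Precedes (F j) x y) (pull λ j → Precedes (F j) y x))
      (Sum.map (_∘ r) (_∘ r))
  where
  pull : ∀ (P : _ → Set) → (∀ i → P (r i)) → ∀ j → P j
  pull P h j = subst P (proj₂ (r-surjective j)) (h (proj₁ (r-surjective j)))

Realizer-reindex : ∀ {K} {G : Graph N} {F : Fin k → List (Fin N)} (r : Fin K → Fin k) →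
                   (∀ j → ∃ λ i → r i ≡ j) → Realizer G F → Realizer G (F ∘ r)
Realizer-reindex r r-surjective (mkRealizer enum realizes) =
  mkRealizer (enum ∘ r) λ x y x≢y → ⇔-sym (Uniform-reindex r r-surjective) ⇔-∘ realizes x y x≢y

clamp : ∀ {K} → Fin K → Fin (suc k)
clamp {k} i = fromℕ< (s≤s (m⊓n≤n (toℕ i) k))

clamp-surjective : ∀ {K} → suc k ≤ K → ∀ j → ∃ λ i → clamp {k} {K} i ≡ j
clamp-surjective {k} k<K j = inject≤ j k<K , toℕ-injective (begin
  toℕ (clamp (inject≤ j k<K)) ≡⟨ toℕ-fromℕ< _ ⟩
  toℕ (inject≤ j k<K) ⊓ k     ≡⟨ cong (_⊓ k) (toℕ-inject≤ j k<K) ⟩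
  toℕ j ⊓ k                   ≡⟨ m≤n⇒m⊓n≡m (toℕ≤pred[n] j) ⟩
  toℕ j                       ∎)
  where open ≡-Reasoning

PermRepresentable-mono : ∀ {G : Graph (suc N)} {K} → k ≤ K → PermRepresentable G k → PermRepresentable G K
PermRepresentable-mono {k = zero} {G = G} _ R = ⊥-elim (PermRepresentable-zero {G = G} R)
PermRepresentable-mono {k = suc k} {G = G} k<K@(s≤s _) R =
  Realizer⇒PermRepresentable
    (Realizer-reindex clamp (clamp-surjective k<K) (proj₂ (PermRepresentable⇒Realizer {G = G} R)))

Uniform-transfer : ∀ {F : Fin k → List A} {F' : Fin k → List B} {x y x' y'} →
                   (∀ i → Enumerates (F i)) → (∀ i → Unique (F' i)) → x ≢ y →
                   (∀ i → Precedes (F i) x y → Precedes (F' i) x' y') →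
                   (∀ i → Precedes (F i) y x → Precedes (F' i) y' x') →
                   Uniform F x y ⇔ Uniform F' x' y'
Uniform-transfer enum unique x≢y forth back = mk⇔
  (Sum.map (λ h i → forth i (h i)) (λ h i → back i (h i)))
  (Sum.map (λ h i → reflect (enum i) (unique i) x≢y (back i) (h i))
           (λ h i → reflect (enum i) (unique i) (≢-sym x≢y) (forth i) (h i)))
  where
  reflect : ∀ {l l' x y x' y'} → Enumerates l → Unique l' → x ≢ y →
            (Precedes l y x → Precedes l' y' x') → Precedes l' x' y' → Precedes l x y
  reflect {x = x} {y} (_ , complete) u' x≢y g q with Precedes-total (complete x) (complete y) x≢y
  ... | inj₁ p = p
  ... | inj₂ p = ⊥-elim (Precedes-asym u' q (g p))

-- Induced subgraphs

preimage : (Fin M → Fin N) → Fin N → Maybe (Fin M)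
preimage f y with any? (λ x → f x ≟ y)
... | yes (x , _) = just x
... | no _        = nothing

preimage-sound : ∀ {f : Fin M → Fin N} {y x} → preimage f y ≡ just x → f x ≡ y
preimage-sound {f = f} {y} eq with any? (λ x → f x ≟ y)
preimage-sound refl | yes (_ , fx≡y) = fx≡y

preimage-complete : ∀ {f : Fin M → Fin N} → Injective _≡_ _≡_ f → ∀ x → preimage f (f x) ≡ just x
preimage-complete {f = f} f-injective x with any? (λ x' → f x' ≟ f x)
... | yes (_ , fx'≡fx) = cong just (f-injective fx'≡fx)
... | no ∄x            = ⊥-elim (∄x (x , refl))

restrict : (Fin M → Fin N) → List (Fin N) → List (Fin M)
restrict f = mapMaybe (preimage f)

module _ {f : Fin M → Fin N} (f-injective : Injective _≡_ _≡_ f) where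

  restrict-enumerates : ∀ {p} → Enumerates p → Enumerates (restrict f p)
  restrict-enumerates (u , complete) =
    Unique-mapMaybe⁺ _ (λ e e' → ≡-trans (≡-sym (preimage-sound e)) (preimage-sound e')) u ,
    λ x → ∈-mapMaybe⁺ _ (complete (f x)) (preimage-complete f-injective x)

  restrict-precedes : ∀ {p x y} → Precedes p (f x) (f y) → Precedes (restrict f p) x y
  restrict-precedes p =
    Precedes-mapMaybe⁺ _ p (preimage-complete f-injective _) (preimage-complete f-injective _)

record Embedding (H : Graph M) (G : Graph N) : Set where
  field
    vertex    : Fin M → Fin N
    injective : Injective _≡_ _≡_ vertex
    adjacent  : ∀ x y → Adj H x y ⇔ Adj G (vertex x) (vertex y)

module _ {H : Graph M} {G : Graph N} (e : Embedding H G) where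

  open Embedding e

  Comparability-restrict : Comparability G → Comparability H
  Comparability-restrict T = record
    { Arc     = λ x y → Arc (vertex x) (vertex y)
    ; arc⇒adj = from (adjacent _ _) ∘ arc⇒adj
    ; adj⇒arc = adj⇒arc ∘ to (adjacent _ _)
    ; antisym = antisym
    ; trans   = trans
    }
    where open TransitiveOrientation T

  Realizer-restrict : ∀ {F : Fin k → List (Fin N)} → Realizer G F → Realizer H (restrict vertex ∘ F)
  Realizer-restrict {F = F} (mkRealizer enum realizes) = mkRealizer enum′ λ x y x≢y → begin
    Adj H x y                         ∼⟨ adjacent x y ⟩
    Adj G (vertex x) (vertex y)       ∼⟨ realizes _ _ (x≢y ∘ injective) ⟩
    Uniform F (vertex x) (vertex y)
      ∼⟨ Uniform-transfer enum (proj₁ ∘ enum′) (x≢y ∘ injective)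
                          (λ _ → restrict-precedes injective) (λ _ → restrict-precedes injective) ⟩
    Uniform (restrict vertex ∘ F) x y ∎
    where
    open EquationalReasoning
    enum′ = restrict-enumerates injective ∘ enum

  PermRepresentable-restrict : PermRepresentable G k → PermRepresentable H k
  PermRepresentable-restrict {k = zero} (Vec.[] , _ , covers , _) =
    Vec.[] , (λ ()) , (λ x → ⊥-elim (absurd x)) , (λ x → ⊥-elim (absurd x))
    where
    absurd : Fin M → ⊥
    absurd x with () ← covers (vertex x)
  PermRepresentable-restrict {k = suc k} R =
    Realizer⇒PermRepresentable (Realizer-restrict (proj₂ (PermRepresentable⇒Realizer {G = G} R)))

-- Substituting a word for a letter

block : List (Fin M) → Fin (suc N) → List (Fin M ⊎ Fin N)
block w fzero    = map inj₁ w
block w (fsuc b) = [ inj₂ b ]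

substitute : List (Fin M) → List (Fin (suc N)) → List (Fin M ⊎ Fin N)
substitute w = concatMap (block w)

host : Fin M ⊎ Fin N → Fin (suc N)
host (inj₁ _) = fzero
host (inj₂ b) = fsuc b

∈-block : ∀ {w : List (Fin M)} → (∀ a → a ∈ w) → ∀ (s : Fin M ⊎ Fin N) → s ∈ block w (host s)
∈-block complete (inj₁ a) = ∈-map⁺ inj₁ (complete a)
∈-block complete (inj₂ b) = here refl

block-disjoint : ∀ {w : List (Fin M)} {z z' : Fin (suc N)} → z ≢ z' → Disjoint (block w z) (block w z')
block-disjoint {z = fzero}  {fzero}   z≢z' _                   = z≢z' refl
block-disjoint {z = fzero}  {fsuc _}  _    (s∈ , here refl)    with _ , _ , () ← ∈-map⁻ inj₁ s∈
block-disjoint {z = fsuc _} {fzero}   _    (here refl , s∈)    with _ , _ , () ← ∈-map⁻ inj₁ s∈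
block-disjoint {z = fsuc _} {fsuc _}  z≢z' (here refl , here refl) = z≢z' refl

substitute-enumerates : ∀ {w : List (Fin M)} {p : List (Fin (suc N))} →
                        Enumerates w → Enumerates p → Enumerates (substitute w p)
substitute-enumerates {w = w} {p} (uw , cw) (up , cp) =
  Unique.concat⁺ (All.map⁺ (All.universal block-unique p))
                 (AllPairs.map⁺ (AllPairs.map block-disjoint up)) ,
  λ s → ∈-concatMap⁺ (block w) (lose (cp (host s)) (∈-block cw s))
  where
  block-unique : ∀ z → Unique (block w z)
  block-unique fzero    = Unique.map⁺ inj₁-injective uw
  block-unique (fsuc _) = [] ∷ []

module _ {w : List (Fin M)} {p : List (Fin (suc N))} where

  substitute-precedes-within : ∀ {a a'} → fzero ∈ p → Precedes w a a' →
                               Precedes (substitute w p) (inj₁ a) (inj₁ a')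
  substitute-precedes-within 0∈p a<a' =
    Precedes-concatMap⁺-within (block w) 0∈p (Precedes-map⁺ inj₁ a<a')

  substitute-precedes-across : ∀ {s t} → (∀ a → a ∈ w) → Precedes p (host s) (host t) →
                               Precedes (substitute w p) s t
  substitute-precedes-across {s} {t} complete hs<ht =
    Precedes-concatMap⁺-across (block w) hs<ht (∈-block complete s) (∈-block complete t)

-- Split recomposition

join-injective : Injective _≡_ _≡_ (join M N)
join-injective {M} {N} {s} {t} eq =
  ≡-trans (≡-sym (splitAt-join M N s)) (≡-trans (cong (splitAt M) eq) (splitAt-join M N t))

splitAt-injective : Injective _≡_ _≡_ (splitAt M {N})
splitAt-injective {M} {N} {x} {y} eq =
  ≡-trans (≡-sym (join-splitAt M N x)) (≡-trans (cong (join M N) eq) (join-splitAt M N y))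

∗-Adj-join : ∀ {n n'} (G : Graph (suc n)) (G' : Graph (suc n')) s t →
             Adj (G ∗ G') (join n n' s) (join n n' t) ≡ SAdj G G' s t
∗-Adj-join {n} {n'} G G' s t = cong₂ (SAdj G G') (splitAt-join n n' s) (splitAt-join n n' t)

module _ {n n' : ℕ} {G : Graph (suc n)} {G' : Graph (suc n')} where

  Realizer-∗ : ∀ {Q : Fin k → List (Fin (n + n'))} → (∀ i → Enumerates (Q i)) →
               (∀ s t → s ≢ t → SAdj G G' s t ⇔ Uniform Q (join n n' s) (join n n' t)) →
               Realizer (G ∗ G') Q
  Realizer-∗ {Q = Q} enum realizes = mkRealizer enum λ x y x≢y →
    subst₂ (λ x' y' → SAdj G G' (splitAt n x) (splitAt n y) ⇔ Uniform Q x' y')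
           (join-splitAt n n' x) (join-splitAt n n' y) (realizes _ _ (x≢y ∘ splitAt-injective))

  SAdj-swap : ∀ s t → SAdj G G' s t ⇔ SAdj G' G (Sum.swap s) (Sum.swap t)
  SAdj-swap (inj₁ _) (inj₁ _) = mk⇔ id id
  SAdj-swap (inj₁ _) (inj₂ _) = mk⇔ ×-swap ×-swap
  SAdj-swap (inj₂ _) (inj₁ _) = mk⇔ ×-swap ×-swap
  SAdj-swap (inj₂ _) (inj₂ _) = mk⇔ id id

  ∗-swap : Embedding (G ∗ G') (G' ∗ G)
  ∗-swap = record
    { vertex    = join n' n ∘ Sum.swap ∘ splitAt n
    ; injective = splitAt-injective ∘ swap-injective ∘ join-injective
    ; adjacent  = λ x y → let s = splitAt n x; t = splitAt n y in
        subst (SAdj G G' s t ⇔_) (≡-sym (∗-Adj-join G' G (Sum.swap s) (Sum.swap t))) (SAdj-swap s t)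
    }
    where
    swap-injective : ∀ {s t : Fin n ⊎ Fin n'} → Sum.swap s ≡ Sum.swap t → s ≡ t
    swap-injective {s} {t} eq =
      ≡-trans (≡-sym (swap-involutive s)) (≡-trans (cong Sum.swap eq) (swap-involutive t))

  ∗-embedʳ : ∀ {a₀} → Adj G fzero (fsuc a₀) → Embedding G' (G ∗ G')
  ∗-embedʳ {a₀} m~a₀ = record
    { vertex    = join n n' ∘ place
    ; injective = place-injective ∘ join-injective
    ; adjacent  = λ x y →
        subst (Adj G' x y ⇔_) (≡-sym (∗-Adj-join G G' (place x) (place y))) (place-adjacent x y)
    }
    where
    place : Fin (suc n') → Fin n ⊎ Fin n'
    place fzero    = inj₁ a₀
    place (fsuc b) = inj₂ b

    place-injective : ∀ {x y} → place x ≡ place y → x ≡ y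
    place-injective {fzero}  {fzero}  _    = refl
    place-injective {fzero}  {fsuc _} ()
    place-injective {fsuc _} {fzero}  ()
    place-injective {fsuc _} {fsuc _} refl = refl

    place-adjacent : ∀ x y → Adj G' x y ⇔ SAdj G G' (place x) (place y)
    place-adjacent fzero    fzero    = mk⇔ (⊥-elim ∘ irrefl G') (⊥-elim ∘ irrefl G)
    place-adjacent fzero    (fsuc _) = mk⇔ (m~a₀ ,_) proj₂
    place-adjacent (fsuc _) fzero    = mk⇔ (λ e → m~a₀ , sym G' e) (sym G' ∘ proj₂)
    place-adjacent (fsuc _) (fsuc _) = mk⇔ id id

neighbour : ∀ {n} {G : Graph (suc n)} → Connected G → Fin n → ∃ λ a → Adj G fzero (fsuc a)
neighbour {G = G} connected v with connected fzero (fsuc v)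
... | _◅_ {j = fzero}  m~m _ = ⊥-elim (irrefl G m~m)
... | _◅_ {j = fsuc a} m~a _ = a , m~a

module Universal {n n' : ℕ} {G : Graph (suc n)} {G' : Graph (suc n')}
                 (universal : ∀ a → Adj G fzero (fsuc a)) where

  ∗-comparable : Comparability G → Comparability G' → Comparability (G ∗ G')
  ∗-comparable T T' = record
    { Arc     = λ x y → SArc (splitAt n x) (splitAt n y)
    ; arc⇒adj = λ {x} {y} → SArc⇒SAdj (splitAt n x) (splitAt n y)
    ; adj⇒arc = λ {x} {y} → SAdj⇒SArc (splitAt n x) (splitAt n y)
    ; antisym = λ {x} {y} → SArc-antisym (splitAt n x) (splitAt n y)
    ; trans   = λ {x} {y} {z} → SArc-trans (splitAt n x) (splitAt n y) (splitAt n z)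
    }
    where
    module T  = TransitiveOrientation T
    module T' = TransitiveOrientation T'

    SArc : Fin n ⊎ Fin n' → Fin n ⊎ Fin n' → Set
    SArc (inj₁ a) (inj₁ a') = T.Arc (fsuc a) (fsuc a')
    SArc s        t         = T'.Arc (host s) (host t)

    SArc⇒SAdj : ∀ s t → SArc s t → SAdj G G' s t
    SArc⇒SAdj (inj₁ _) (inj₁ _) = T.arc⇒adj
    SArc⇒SAdj (inj₁ a) (inj₂ _) = λ arc → universal a , T'.arc⇒adj arc
    SArc⇒SAdj (inj₂ _) (inj₁ a) = λ arc → universal a , sym G' (T'.arc⇒adj arc)
    SArc⇒SAdj (inj₂ _) (inj₂ _) = T'.arc⇒adj

    SAdj⇒SArc : ∀ s t → SAdj G G' s t → SArc s t ⊎ SArc t s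
    SAdj⇒SArc (inj₁ _) (inj₁ _) = T.adj⇒arc
    SAdj⇒SArc (inj₁ _) (inj₂ _) = T'.adj⇒arc ∘ proj₂
    SAdj⇒SArc (inj₂ _) (inj₁ _) = Sum.swap ∘ T'.adj⇒arc ∘ proj₂
    SAdj⇒SArc (inj₂ _) (inj₂ _) = T'.adj⇒arc

    SArc-antisym : ∀ s t → SArc s t → ¬ SArc t s
    SArc-antisym (inj₁ _) (inj₁ _) = T.antisym
    SArc-antisym (inj₁ _) (inj₂ _) = T'.antisym
    SArc-antisym (inj₂ _) (inj₁ _) = T'.antisym
    SArc-antisym (inj₂ _) (inj₂ _) = T'.antisym

    SArc-trans : ∀ s t u → SArc s t → SArc t u → SArc s u
    SArc-trans (inj₁ _) (inj₁ _) (inj₁ _) = T.trans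
    SArc-trans (inj₁ _) (inj₁ _) (inj₂ _) = λ _ arc → arc
    SArc-trans (inj₂ _) (inj₁ _) (inj₁ _) = λ arc _ → arc
    SArc-trans (inj₁ _) (inj₂ _) (inj₁ _) = λ arc arc' → ⊥-elim (T'.antisym arc arc')
    SArc-trans (inj₁ _) (inj₂ _) (inj₂ _) = T'.trans
    SArc-trans (inj₂ _) (inj₁ _) (inj₂ _) = T'.trans
    SArc-trans (inj₂ _) (inj₂ _) (inj₁ _) = T'.trans
    SArc-trans (inj₂ _) (inj₂ _) (inj₂ _) = T'.trans

  ∗-realizer : ∀ {F : Fin k → List (Fin (suc n))} {F' : Fin k → List (Fin (suc n'))} →
               Realizer G F → Realizer G' F' →
               Realizer (G ∗ G') (λ i → map (join n n') (substitute (restrict fsuc (F i)) (F' i)))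
  ∗-realizer {F = F} {F'} (mkRealizer enum realizes) (mkRealizer enum' realizes') =
    Realizer-∗ enumQ realizesQ
    where
    open EquationalReasoning

    Q = λ i → map (join n n') (substitute (restrict fsuc (F i)) (F' i))

    enumV = λ i → restrict-enumerates suc-injective (enum i)

    enumQ : ∀ i → Enumerates (Q i)
    enumQ i = Enumerates-map⁺ join-injective (λ z → splitAt n z , join-splitAt n n' z)
                              (substitute-enumerates (enumV i) (enum' i))

    within : ∀ i {a a'} → Precedes (F i) (fsuc a) (fsuc a') →
             Precedes (Q i) (join n n' (inj₁ a)) (join n n' (inj₁ a'))
    within i = Precedes-map⁺ (join n n') ∘ substitute-precedes-within (proj₂ (enum' i) fzero)
                                         ∘ restrict-precedes suc-injective

    across : ∀ i {s t} → Precedes (F' i) (host s) (host t) → Precedes (Q i) (join n n' s) (join n n' t)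
    across i = Precedes-map⁺ (join n n') ∘ substitute-precedes-across (proj₂ (enumV i))

    viaG' : ∀ s t → host s ≢ host t → SAdj G G' s t ⇔ Adj G' (host s) (host t) →
            SAdj G G' s t ⇔ Uniform Q (join n n' s) (join n n' t)
    viaG' s t hs≢ht adj = begin
      SAdj G G' s t                         ∼⟨ adj ⟩
      Adj G' (host s) (host t)              ∼⟨ realizes' _ _ hs≢ht ⟩
      Uniform F' (host s) (host t)
        ∼⟨ Uniform-transfer enum' (proj₁ ∘ enumQ) hs≢ht (λ i → across i) (λ i → across i) ⟩
      Uniform Q (join n n' s) (join n n' t) ∎

    realizesQ : ∀ s t → s ≢ t → SAdj G G' s t ⇔ Uniform Q (join n n' s) (join n n' t)
    realizesQ (inj₁ a) (inj₁ a') s≢t = begin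
      Adj G (fsuc a) (fsuc a')     ∼⟨ realizes _ _ a≢a' ⟩
      Uniform F (fsuc a) (fsuc a')
        ∼⟨ Uniform-transfer enum (proj₁ ∘ enumQ) a≢a' (λ i → within i) (λ i → within i) ⟩
      Uniform Q (join n n' (inj₁ a)) (join n n' (inj₁ a')) ∎
      where a≢a' = s≢t ∘ cong inj₁ ∘ suc-injective
    realizesQ s@(inj₁ a) t@(inj₂ _) _   = viaG' s t (λ ()) (mk⇔ proj₂ (universal a ,_))
    realizesQ s@(inj₂ _) t@(inj₁ a) _   = viaG' s t (λ ()) (mk⇔ (sym G' ∘ proj₂) (λ e → universal a , sym G' e))
    realizesQ s@(inj₂ _) t@(inj₂ _) s≢t = viaG' s t (s≢t ∘ cong inj₂ ∘ suc-injective) (mk⇔ id id)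

  ∗-permRepresentable : PermRepresentable G k → PermRepresentable G' k → PermRepresentable (G ∗ G') k
  ∗-permRepresentable {k = zero}  R _  = ⊥-elim (PermRepresentable-zero {G = G} R)
  ∗-permRepresentable {k = suc k} R R' = Realizer⇒PermRepresentable
    (∗-realizer (proj₂ (PermRepresentable⇒Realizer {G = G} R))
                (proj₂ (PermRepresentable⇒Realizer {G = G'} R')))

module _ {n n' : ℕ} {G : Graph (suc n)} {G' : Graph (suc n')} where

  ∗-comparable : (∀ a → Adj G fzero (fsuc a)) ⊎ (∀ b → Adj G' fzero (fsuc b)) →
                 Comparability G → Comparability G' → Comparability (G ∗ G')
  ∗-comparable (inj₁ universal) T T' = Universal.∗-comparable {G' = G'} universal T T'
  ∗-comparable (inj₂ universal) T T' =
    Comparability-restrict (∗-swap {G = G} {G'}) (Universal.∗-comparable universal T' T)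

  ∗-permRepresentable : (∀ a → Adj G fzero (fsuc a)) ⊎ (∀ b → Adj G' fzero (fsuc b)) →
                        PermRepresentable G k → PermRepresentable G' k → PermRepresentable (G ∗ G') k
  ∗-permRepresentable (inj₁ universal) R R' = Universal.∗-permRepresentable {G' = G'} universal R R'
  ∗-permRepresentable (inj₂ universal) R R' =
    PermRepresentable-restrict (∗-swap {G = G} {G'}) (Universal.∗-permRepresentable universal R' R)

  PermRepresentable-∗⁻ˡ : Connected G' → Fin n' → PermRepresentable (G ∗ G') k → PermRepresentable G k
  PermRepresentable-∗⁻ˡ connected' v =
    PermRepresentable-restrict (∗-embedʳ {G = G'} {G} (proj₂ (neighbour {G = G'} connected' v)))
    ∘ PermRepresentable-restrict (∗-swap {G = G'} {G})

  PermRepresentable-∗⁻ʳ : Connected G → Fin n → PermRepresentable (G ∗ G') k → PermRepresentable G' k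
  PermRepresentable-∗⁻ʳ connected v =
    PermRepresentable-restrict (∗-embedʳ {G = G} {G'} (proj₂ (neighbour {G = G} connected v)))

theorem7 : ∀ {n n' : ℕ} (G : Graph (suc n)) (G' : Graph (suc n')) →
    1 ≤ n → 1 ≤ n' →
    Connected G → Connected G' →
    Comparability G → Comparability G' →
    ((∀ (v : Fin n) → Adj G fzero (fsuc v)) ⊎ (∀ (v : Fin n') → Adj G' fzero (fsuc v))) →
    Comparability (G ∗ G') ×
    (∀ (k k' : ℕ) → Rp≡ G k → Rp≡ G' k' → Rp≡ (G ∗ G') (k ⊔ k'))
theorem7 G G' (s≤s _) (s≤s _) connected connected' T T' universal =
  ∗-comparable universal T T' , λ k k' (Rk , minimal) (Rk' , minimal') →
    ∗-permRepresentable universal (PermRepresentable-mono {G = G} (m≤m⊔n k k') Rk)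
                                  (PermRepresentable-mono {G = G'} (m≤n⊔m k k') Rk') ,
    λ j R → ⊔-lub (minimal j (PermRepresentable-∗⁻ˡ connected' fzero R))
                  (minimal' j (PermRepresentable-∗⁻ʳ connected fzero R))
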